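{- For every positive integer $n$, the set $\mathscr{C}_{F_{2k-1}}(n)$ of compositions of $n$ in which each part equal to $k$ comes in $F_{2k-1}$ colors is in one-to-one correspondence with the set of unimodal sequences of length $n$ covering an initial interval of positive integers. These sets are enumerated by the sequence $1,3,10,34,116,396,1352,4616,\dots$, i.e. their common cardinality $b_n$ satisfies $b_1=1$, $b_2=3$, $b_n=4b_{n-1}-2b_{n-2}$ for $n\ge3$.
   Context: $F_0=0$, $F_1=1$, $F_n=F_{n-1}+F_{n-2}$ are the Fibonacci numbers. A $w$-colored composition of $n$ (for a sequence $(w_k)$ of nonnegative integers) is a composition $(j_1,\dots,j_m)$ of $n$ together with a choice of one of $w_{j_i}$ colors for each part $j_i$; $\mathscr{C}_{w_k}(n)$ is the set of these. A sequence $(a_1,\dots,a_n)$ of positive integers is unimodal if there is an index $t$ with $a_1\le\dots\le a_t\ge a_{t+1}\ge\dots\ge a_n$; it covers an initial interval of positive integers if $\{a_1,\dots,a_n\}=\{1,2,\dots,m\}$ for some $m$. -}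

module Defs where

open import Level using (0ℓ)
open import Data.Nat using (ℕ; zero; suc; _+_; _*_; _∸_; _≤_)
open import Data.Fin using (Fin) renaming (_≤_ to _≤ᶠ_)
open import Data.List using (List; map)
open import Data.Nat.ListAction using (sum)
open import Data.List.Relation.Unary.All using (All)
open import Data.Product using (Σ; ∃; ∃-syntax; _×_; proj₁)
open import Function.Bundles using (_⇔_)
open import Relation.Binary.Bundles using (Setoid)
open import Relation.Binary.PropositionalEquality using (_≡_)
import Relation.Binary.PropositionalEquality as ≡
import Relation.Binary.Construct.On as On

F : ℕ → ℕ
F zero = 0
F (suc zero) = 1
F (suc (suc n)) = F (suc n) + F n

-- the weight sequence w_k = F_{2k-1} (only used for k ≥ 1)
wF : ℕ → ℕ
wF k = F (2 * k ∸ 1)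

ColoredPart : (ℕ → ℕ) → Set
ColoredPart w = Σ ℕ (λ j → Fin (w j))

IsColComp : (w : ℕ → ℕ) → ℕ → List (ColoredPart w) → Set
IsColComp w n c = All (λ p → 1 ≤ proj₁ p) c × sum (map proj₁ c) ≡ n

-- The set 𝒞_w(n), as a setoid: elements are colored-part lists with a
-- proof of membership; two elements are equal iff the lists are equal
-- (the membership proof is irrelevant — this is a subset).
𝒞 : (w : ℕ → ℕ) → ℕ → Setoid 0ℓ 0ℓ
𝒞 w n = On.setoid {B = Σ (List (ColoredPart w)) (IsColComp w n)}
                  (≡.setoid (List (ColoredPart w))) proj₁

Positive : ∀ {n} → (Fin n → ℕ) → Set
Positive a = ∀ i → 1 ≤ a i

Unimodal : ∀ {n} → (Fin n → ℕ) → Set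
Unimodal {n} a = Σ (Fin n) λ t → ((∀ i j → i ≤ᶠ j → j ≤ᶠ t → a i ≤ a j)
                      × (∀ i j → t ≤ᶠ i → i ≤ᶠ j → a j ≤ a i))

CoversInitialInterval : ∀ {n} → (Fin n → ℕ) → Set
CoversInitialInterval a =
  ∃[ m ] (∀ x → (∃[ i ] a i ≡ x) ⇔ (1 ≤ x × x ≤ m))

IsUnimodalCovering : ∀ n → (Fin n → ℕ) → Set
IsUnimodalCovering n a = Positive a × Unimodal a × CoversInitialInterval a

𝒰 : ℕ → Setoid 0ℓ 0ℓ
𝒰 n = record
  { Carrier = Σ (Fin n → ℕ) (IsUnimodalCovering n)
  ; _≈_ = λ a b → ∀ i → proj₁ a i ≡ proj₁ b i
  ; isEquivalence = record
    { refl = λ i → ≡.refl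
    ; sym = λ p i → ≡.sym (p i)
    ; trans = λ p q i → ≡.trans (p i) (q i)
    }
  }

-- b_1 = 1, b_2 = 3, b_n = 4 b_{n-1} - 2 b_{n-2} (n ≥ 3); b_0 unused.
b : ℕ → ℕ
b zero = 0
b (suc zero) = 1
b (suc (suc zero)) = 3
b (suc (suc (suc n))) = 4 * b (suc (suc n)) ∸ 2 * b (suc n)

-- Coloured compositions of n and unimodal coverings of length n are both in bijection
-- with the codes of size n of an unambiguous grammar.  A code of size n + 2 is a code
-- of size n + 1 prefixed by 1 (cons1), a code of size n + 1 with every entry raised by
-- one and prefixed by 1 (cons1↑), or a tall code; a tall code of size n + 2 is a raised
-- code of size n + 1 followed by 1 (snoc1↑) or a tall code of size n + 1 followed by 1
-- (snoc1).  On sequences the tall codes are the unimodal coverings not starting with 1;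
-- these end with 1, since 1 is the minimum.  Removing a leading or trailing 1 leaves a
-- covering if another 1 remains, and a raised covering otherwise.  On compositions,
-- cons1 opens a new part 1 while every other constructor enlarges the first part by
-- one, sending its colour into a block of F (2k+1) = F (2k) + F (2k-1) or of
-- F (2k) = F (2k-1) + F (2k-2).  Counting codes, b n = 2 b (n-1) + g n and
-- g n = b (n-1) + g (n-1), whence b n = 4 b (n-1) - 2 b (n-2).

module Submission where

open import Defs
open import Data.Nat using (ℕ; zero; suc; _+_; _*_; _∸_; _≤_; z≤n; s≤s; pred; _≟_; >-nonZero)
open import Data.Nat.Properties
  using ( ≤-refl; ≤-trans; ≤-antisym; ≤-total; ≤-pred; ∸-monoʳ-≤; pred-mono-≤; suc-pred
        ; suc-injective; +-suc; +-identityʳ; m+n∸n≡m; ≡-irrelevant)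
open import Data.Nat.ListAction using (sum)
open import Data.Nat.Solver using (module +-*-Solver)
open import Data.Fin
  using (Fin; zero; suc; toℕ; fromℕ; inject₁; opposite; cast; splitAt; join; _↑ˡ_; _↑ʳ_)
  renaming (_≤_ to _≤ᶠ_)
open import Data.Fin.Properties
  using ( +↔⊎; any?; opposite-prop; opposite-involutive; ≤fromℕ
        ; splitAt-↑ˡ; splitAt-↑ʳ; join-splitAt; cast-involutive)
open import Data.Vec.Functional using (Vector; _∷_; head; tail; map; reverse; init; last)
open import Data.List using (List; []) renaming (_∷_ to _∷ₗ_)
import Data.List as List
open import Data.List.Relation.Unary.All using (universal)
open import Data.Product using (Σ; ∃-syntax; _×_; _,_; proj₁; proj₂)
open import Data.Sum using (_⊎_; inj₁; inj₂)
open import Data.Sum.Function.Propositional using (_⊎-↔_)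
open import Data.Empty using (⊥; ⊥-elim)
open import Function using (_∘_)
open import Function.Bundles using (_⇔_; mk⇔; Equivalence; Inverse; Bijection; _↔_; mk↔ₛ′)
open import Function.Definitions using (Congruent; StrictlyInverseˡ; StrictlyInverseʳ)
open import Function.Properties.Inverse using (↔-refl; ↔-sym; ↔-trans; Inverse⇒Bijection)
import Function.Consequences.Setoid as Consequences
import Function.Construct.Composition as Compose
import Function.Construct.Symmetry as Symmetry
open import Relation.Binary.Bundles using (Setoid)
open import Relation.Nullary using (¬_; Dec; yes; no)
open import Relation.Binary.PropositionalEquality
  using (_≡_; _≢_; _≗_; refl; sym; trans; cong; cong₂; subst; subst₂; module ≡-Reasoning)
import Relation.Binary.PropositionalEquality as ≡

-- The grammar and its count

data Code : ℕ → Set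
data Code⁺ : ℕ → Set

data Code where
  single : Code 1
  cons1 cons1↑ : ∀ {n} → Code (suc n) → Code (suc (suc n))
  tall : ∀ {n} → Code⁺ (suc (suc n)) → Code (suc (suc n))

data Code⁺ where
  snoc1↑ : ∀ {n} → Code (suc n) → Code⁺ (suc (suc n))
  snoc1 : ∀ {n} → Code⁺ (suc n) → Code⁺ (suc (suc n))

#Code #Code⁺ : ℕ → ℕ
#Code zero = 0
#Code (suc zero) = 1
#Code (suc (suc n)) = (#Code (suc n) + #Code (suc n)) + #Code⁺ (suc (suc n))
#Code⁺ zero = 0
#Code⁺ (suc zero) = 0
#Code⁺ (suc (suc n)) = #Code (suc n) + #Code⁺ (suc n)

Code-unfold : ∀ {n} → Code (suc (suc n)) ↔ ((Code (suc n) ⊎ Code (suc n)) ⊎ Code⁺ (suc (suc n)))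
Code-unfold {n} = mk↔ₛ′ to from
  (λ { (inj₁ (inj₁ _)) → refl ; (inj₁ (inj₂ _)) → refl ; (inj₂ _) → refl })
  (λ { (cons1 _) → refl ; (cons1↑ _) → refl ; (tall _) → refl })
  where
  to : Code (suc (suc n)) → (Code (suc n) ⊎ Code (suc n)) ⊎ Code⁺ (suc (suc n))
  to (cons1 y) = inj₁ (inj₁ y)
  to (cons1↑ y) = inj₁ (inj₂ y)
  to (tall z) = inj₂ z
  from : (Code (suc n) ⊎ Code (suc n)) ⊎ Code⁺ (suc (suc n)) → Code (suc (suc n))
  from (inj₁ (inj₁ y)) = cons1 y
  from (inj₁ (inj₂ y)) = cons1↑ y
  from (inj₂ z) = tall z

Code⁺-unfold : ∀ {n} → Code⁺ (suc (suc n)) ↔ (Code (suc n) ⊎ Code⁺ (suc n))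
Code⁺-unfold {n} = mk↔ₛ′ to from
  (λ { (inj₁ _) → refl ; (inj₂ _) → refl })
  (λ { (snoc1↑ _) → refl ; (snoc1 _) → refl })
  where
  to : Code⁺ (suc (suc n)) → Code (suc n) ⊎ Code⁺ (suc n)
  to (snoc1↑ y) = inj₁ y
  to (snoc1 z) = inj₂ z
  from : Code (suc n) ⊎ Code⁺ (suc n) → Code⁺ (suc (suc n))
  from (inj₁ y) = snoc1↑ y
  from (inj₂ z) = snoc1 z

Code↔Fin : ∀ n → Code n ↔ Fin (#Code n)
Code⁺↔Fin : ∀ n → Code⁺ n ↔ Fin (#Code⁺ n)
Code↔Fin zero = mk↔ₛ′ (λ ()) (λ ()) (λ ()) (λ ())
Code↔Fin (suc zero) = mk↔ₛ′ (λ _ → zero) (λ _ → single) (λ { zero → refl }) (λ { single → refl })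
Code↔Fin (suc (suc n)) =
  ↔-trans Code-unfold
    (↔-trans ((Code↔Fin (suc n) ⊎-↔ Code↔Fin (suc n)) ⊎-↔ Code⁺↔Fin (suc (suc n)))
             (↔-sym (↔-trans +↔⊎ (+↔⊎ ⊎-↔ ↔-refl))))
Code⁺↔Fin zero = mk↔ₛ′ (λ ()) (λ ()) (λ ()) (λ ())
Code⁺↔Fin (suc zero) = mk↔ₛ′ (λ ()) (λ ()) (λ ()) (λ ())
Code⁺↔Fin (suc (suc n)) =
  ↔-trans Code⁺-unfold (↔-trans (Code↔Fin (suc n) ⊎-↔ Code⁺↔Fin (suc n)) (↔-sym +↔⊎))

b≡#Code : ∀ n → b n ≡ #Code n
b≡#Code zero = refl
b≡#Code (suc zero) = refl
b≡#Code (suc (suc zero)) = refl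
b≡#Code (suc (suc (suc n))) = begin
  4 * b (2 + n) ∸ 2 * b (1 + n)
    ≡⟨ cong₂ (λ x y → 4 * x ∸ 2 * y) (b≡#Code (suc (suc n))) (b≡#Code (suc n)) ⟩
  4 * #Code (2 + n) ∸ 2 * #Code (1 + n)
    ≡⟨ cong (_∸ 2 * #Code (1 + n)) (four-times (#Code (1 + n)) (#Code⁺ (2 + n))) ⟩
  #Code (3 + n) + 2 * #Code (1 + n) ∸ 2 * #Code (1 + n)
    ≡⟨ m+n∸n≡m (#Code (3 + n)) (2 * #Code (1 + n)) ⟩
  #Code (3 + n)
    ∎
  where
  open ≡-Reasoning
  open +-*-Solver
  -- With B = #Code (1 + n) and G = #Code⁺ (2 + n), the right side is #Code (3 + n) + 2 * B unfolded.
  four-times : ∀ B G → 4 * ((B + B) + G) ≡ ((((B + B) + G) + ((B + B) + G)) + (((B + B) + G) + G)) + 2 * B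
  four-times = solve 2 (λ B G → con 4 :* ((B :+ B) :+ G)
                              := ((((B :+ B) :+ G) :+ ((B :+ B) :+ G)) :+ (((B :+ B) :+ G) :+ G)) :+ con 2 :* B) refl

Seq : ℕ → Set
Seq = Vector ℕ

infixl 5 _∷ʳ_
infix 4 _∈_ _∉_ _∈?_

_∷ʳ_ : ∀ {n} → Seq n → ℕ → Seq (suc n)
s ∷ʳ x = reverse (x ∷ reverse s)

_∈_ : ∀ {n} → ℕ → Seq n → Set
x ∈ s = ∃[ i ] s i ≡ x

_∉_ : ∀ {n} → ℕ → Seq n → Set
x ∉ s = ¬ x ∈ s

_∈?_ : ∀ {n} x (s : Seq n) → Dec (x ∈ s)
x ∈? s = any? (λ i → s i ≟ x)

opposite-anti : ∀ {n} {i j : Fin n} → i ≤ᶠ j → opposite j ≤ᶠ opposite i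
opposite-anti {n} {i} {j} i≤j rewrite opposite-prop i | opposite-prop j = ∸-monoʳ-≤ n (s≤s i≤j)

≤-opposite : ∀ {n} {i j : Fin n} → i ≤ᶠ opposite j → j ≤ᶠ opposite i
≤-opposite {j = j} i≤j = subst (_≤ᶠ _) (opposite-involutive j) (opposite-anti i≤j)

opposite-≤ : ∀ {n} {i j : Fin n} → opposite i ≤ᶠ j → opposite j ≤ᶠ i
opposite-≤ {i = i} i≤j = subst (_ ≤ᶠ_) (opposite-involutive i) (opposite-anti i≤j)

opposite-inject₁ : ∀ {n} (i : Fin n) → opposite (inject₁ i) ≡ suc (opposite i)
opposite-inject₁ i = begin
  opposite (inject₁ i)                      ≡⟨ cong (opposite ∘ inject₁) (opposite-involutive i) ⟨
  opposite (opposite (suc (opposite i)))    ≡⟨ opposite-involutive (suc (opposite i)) ⟩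
  suc (opposite i)                          ∎
  where open ≡-Reasoning

reverse-involutive : ∀ {n} (s : Seq n) → reverse (reverse s) ≗ s
reverse-involutive s i = cong s (opposite-involutive i)

∷ʳ-cong : ∀ {n} {s s' : Seq n} {x} → s ≗ s' → s ∷ʳ x ≗ s' ∷ʳ x
∷ʳ-cong e i with opposite i
... | zero = refl
... | suc j = e (opposite j)

head-∷ʳ : ∀ {n} (s : Seq (suc n)) x → head (s ∷ʳ x) ≡ head s
head-∷ʳ s x = cong s (opposite-involutive zero)

init-∷ʳ : ∀ {n} (s : Seq n) x → init (s ∷ʳ x) ≗ s
init-∷ʳ s x i = trans (cong (x ∷ reverse s) (opposite-inject₁ i)) (reverse-involutive s i)

init-∷ʳ-last : ∀ {n} (s : Seq (suc n)) → init s ∷ʳ last s ≗ s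
init-∷ʳ-last s i = trans (unfold (opposite i)) (reverse-involutive s i)
  where
  unfold : ∀ j → (last s ∷ reverse (init s)) j ≡ reverse s j
  unfold zero = refl
  unfold (suc j) = refl

∷ʳ-injective : ∀ {n} {s s' : Seq n} {x y} → s ∷ʳ x ≗ s' ∷ʳ y → s ≗ s'
∷ʳ-injective {s = s} {s'} {x} {y} e i =
  trans (sym (init-∷ʳ s x i)) (trans (e (inject₁ i)) (init-∷ʳ s' y i))

∈-resp : ∀ {n} {s s' : Seq n} {x} → s ≗ s' → x ∈ s → x ∈ s'
∈-resp e (i , sᵢ≡x) = i , trans (sym (e i)) sᵢ≡x

∈-reverse : ∀ {n} {s : Seq n} {x} → x ∈ s → x ∈ reverse s
∈-reverse {s = s} (i , sᵢ≡x) = opposite i , trans (reverse-involutive s i) sᵢ≡x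

∈-reverse⁻¹ : ∀ {n} {s : Seq n} {x} → x ∈ reverse s → x ∈ s
∈-reverse⁻¹ (i , sᵢ≡x) = opposite i , sᵢ≡x

-- Unimodal coverings

unimodal-resp : ∀ {n} {s s' : Seq n} → s ≗ s' → Unimodal s → Unimodal s'
unimodal-resp e (t , up , down) =
  t , (λ i j i≤j j≤t → subst₂ _≤_ (e i) (e j) (up i j i≤j j≤t))
    , (λ i j t≤i i≤j → subst₂ _≤_ (e j) (e i) (down i j t≤i i≤j))

unimodal-map : ∀ {n} {s : Seq n} (f : ℕ → ℕ) → (∀ {x y} → x ≤ y → f x ≤ f y) →
               Unimodal s → Unimodal (map f s)
unimodal-map f mono (t , up , down) =
  t , (λ i j i≤j j≤t → mono (up i j i≤j j≤t)) , (λ i j t≤i i≤j → mono (down i j t≤i i≤j))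

unimodal-reverse : ∀ {n} {s : Seq n} → Unimodal s → Unimodal (reverse s)
unimodal-reverse (t , up , down) =
  opposite t
  , (λ i j i≤j j≤t → down (opposite j) (opposite i) (≤-opposite j≤t) (opposite-anti i≤j))
  , (λ i j t≤i i≤j → up (opposite j) (opposite i) (opposite-anti i≤j) (opposite-≤ t≤i))

unimodal-∷ : ∀ {n} {s : Seq (suc n)} {x} → (∀ i → x ≤ s i) → Unimodal s → Unimodal (x ∷ s)
unimodal-∷ {s = s} {x} x≤s (t , up , down) = suc t , up′ , down′
  where
  up′ : ∀ i j → i ≤ᶠ j → j ≤ᶠ suc t → (x ∷ s) i ≤ (x ∷ s) j
  up′ zero zero _ _ = ≤-refl
  up′ zero (suc j) _ _ = x≤s j
  up′ (suc i) (suc j) i≤j j≤t = up i j (≤-pred i≤j) (≤-pred j≤t)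
  down′ : ∀ i j → suc t ≤ᶠ i → i ≤ᶠ j → (x ∷ s) j ≤ (x ∷ s) i
  down′ (suc i) (suc j) t≤i i≤j = down i j (≤-pred t≤i) (≤-pred i≤j)

unimodal-tail : ∀ {n} {s : Seq (suc (suc n))} → Unimodal s → Unimodal (tail s)
unimodal-tail {n} {s} (zero , _ , down) = zero , up′ , λ i j _ i≤j → down (suc i) (suc j) z≤n (s≤s i≤j)
  where
  up′ : ∀ (i j : Fin (suc n)) → i ≤ᶠ j → j ≤ᶠ zero {suc n} → s (suc i) ≤ s (suc j)
  up′ zero zero _ _ = ≤-refl
unimodal-tail (suc t , up , down) =
  t , (λ i j i≤j j≤t → up (suc i) (suc j) (s≤s i≤j) (s≤s j≤t))
    , (λ i j t≤i i≤j → down (suc i) (suc j) (s≤s t≤i) (s≤s i≤j))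

Covers : ∀ {n} → ℕ → Seq n → Set
Covers m s = ∀ x → x ∈ s ⇔ (1 ≤ x × x ≤ m)

module _ {n m} {s : Seq n} (cov : Covers m s) where

  covered : ∀ {x} → x ∈ s → 1 ≤ x × x ≤ m
  covered {x} = Equivalence.to (cov x)

  covering : ∀ {x} → 1 ≤ x × x ≤ m → x ∈ s
  covering {x} = Equivalence.from (cov x)

covers-resp : ∀ {n m} {s s' : Seq n} → s ≗ s' → Covers m s → Covers m s'
covers-resp e cov x = mk⇔ (covered cov ∘ ∈-resp (sym ∘ e)) (∈-resp e ∘ covering cov)

covers-reverse : ∀ {n m} {s : Seq n} → Covers m s → Covers m (reverse s)
covers-reverse cov x = mk⇔ (covered cov ∘ ∈-reverse⁻¹) (∈-reverse ∘ covering cov)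

covers-∷ : ∀ {n m} {s : Seq n} {y} → y ∈ s → Covers m s → Covers m (y ∷ s)
covers-∷ {s = s} {y} y∈s cov x = mk⇔ to (λ r → let (i , sᵢ≡x) = covering cov r in suc i , sᵢ≡x)
  where
  to : x ∈ y ∷ s → 1 ≤ x × x ≤ _
  to (zero , refl) = covered cov y∈s
  to (suc i , sᵢ≡x) = covered cov (i , sᵢ≡x)

covers-tail : ∀ {n m} {s : Seq (suc n)} → head s ∈ tail s → Covers m s → Covers m (tail s)
covers-tail {s = s} head∈tail cov x = mk⇔ (λ (i , sᵢ≡x) → covered cov (suc i , sᵢ≡x)) from
  where
  from : 1 ≤ x × x ≤ _ → x ∈ tail s
  from r with covering cov r
  ... | zero , refl = head∈tail
  ... | suc i , sᵢ≡x = i , sᵢ≡x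

covers-1∷suc : ∀ {n m} {s : Seq n} → Covers m s → Covers (suc m) (1 ∷ map suc s)
covers-1∷suc {m = m} {s} cov x = mk⇔ to from
  where
  to : ∀ {x} → x ∈ 1 ∷ map suc s → 1 ≤ x × x ≤ suc m
  to (zero , refl) = s≤s z≤n , s≤s z≤n
  to (suc i , refl) = s≤s z≤n , s≤s (proj₂ (covered cov (i , refl)))
  from : ∀ {x} → 1 ≤ x × x ≤ suc m → x ∈ 1 ∷ map suc s
  from {suc zero} _ = zero , refl
  from {suc (suc x)} (_ , s≤s x<m) =
    let (i , sᵢ≡x) = covering cov (s≤s z≤n , x<m) in suc i , cong suc sᵢ≡x

covers-1∷suc⁻¹ : ∀ {n m} {s : Seq n} → Positive s → Covers m (1 ∷ map suc s) → Covers (pred m) s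
covers-1∷suc⁻¹ {m = m} {s} pos cov x = mk⇔ to (from m cov)
  where
  to : x ∈ s → 1 ≤ x × x ≤ pred m
  to (i , refl) = pos i , pred-mono-≤ (proj₂ (covered cov (suc i , refl)))
  from : ∀ m → Covers m (1 ∷ map suc s) → 1 ≤ x × x ≤ pred m → x ∈ s
  from zero _ (s≤s _ , ())
  from (suc m) cov (1≤x , x≤m) with covering cov (s≤s z≤n , s≤s x≤m)
  ... | suc i , sᵢ≡x = i , suc-injective sᵢ≡x
  ... | zero , refl with () ← 1≤x

Valid : ∀ {n} → Seq n → Set
Valid {n} = IsUnimodalCovering n

valid-resp : ∀ {n} {s s' : Seq n} → s ≗ s' → Valid s → Valid s'
valid-resp e (pos , uni , m , cov) =
  (λ i → subst (1 ≤_) (e i) (pos i)) , unimodal-resp e uni , m , covers-resp e cov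

valid-reverse : ∀ {n} {s : Seq n} → Valid s → Valid (reverse s)
valid-reverse (pos , uni , m , cov) = pos ∘ opposite , unimodal-reverse uni , m , covers-reverse cov

valid-reverse⁻¹ : ∀ {n} {s : Seq n} → Valid (reverse s) → Valid s
valid-reverse⁻¹ {s = s} = valid-resp (reverse-involutive s) ∘ valid-reverse

valid-single : Valid {1} (λ _ → 1)
valid-single =
  (λ _ → ≤-refl) , (zero , (λ _ _ _ _ → ≤-refl) , (λ _ _ _ _ → ≤-refl))
  , 1 , λ _ → mk⇔ (λ { (_ , refl) → ≤-refl , ≤-refl })
                  (λ (1≤x , x≤1) → zero , ≤-antisym 1≤x x≤1)

valid⇒1∈ : ∀ {n} {s : Seq (suc n)} → Valid s → 1 ∈ s
valid⇒1∈ (_ , _ , _ , cov) =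
  let (1≤s₀ , s₀≤m) = covered cov (zero , refl) in covering cov (s≤s z≤n , ≤-trans 1≤s₀ s₀≤m)

valid-last≡1 : ∀ {n} {s : Seq (suc n)} → Valid s → head s ≢ 1 → last s ≡ 1
valid-last≡1 {n} {s} v@(pos , (t , up , down) , _) head≢1 with valid⇒1∈ v
... | i , sᵢ≡1 with ≤-total (toℕ i) (toℕ t)
...   | inj₁ i≤t =
  ⊥-elim (head≢1 (≤-antisym (subst (head s ≤_) sᵢ≡1 (up zero i z≤n i≤t)) (pos zero)))
...   | inj₂ t≤i =
  ≤-antisym (subst (last s ≤_) sᵢ≡1 (down i (fromℕ n) t≤i (≤fromℕ i))) (pos (fromℕ n))

init-∷ʳ-1 : ∀ {n} {s : Seq (suc n)} → Valid s → head s ≢ 1 → init s ∷ʳ 1 ≗ s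
init-∷ʳ-1 {s = s} v head≢1 =
  subst (λ x → init s ∷ʳ x ≗ s) (valid-last≡1 v head≢1) (init-∷ʳ-last s)

valid-1∷ : ∀ {n} {s : Seq (suc n)} → Valid s → Valid (1 ∷ s)
valid-1∷ v@(pos , uni , m , cov) =
  (λ { zero → s≤s z≤n ; (suc i) → pos i }) , unimodal-∷ pos uni , m , covers-∷ (valid⇒1∈ v) cov

valid-tail : ∀ {n} {s : Seq (suc (suc n))} → Valid s → head s ∈ tail s → Valid (tail s)
valid-tail (pos , uni , m , cov) head∈tail = pos ∘ suc , unimodal-tail uni , m , covers-tail head∈tail cov

valid-init : ∀ {n} {s : Seq (suc (suc n))} → Valid s → last s ∈ init s → Valid (init s)
valid-init v last∈init = valid-reverse⁻¹ (valid-tail (valid-reverse v) (∈-reverse last∈init))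

valid-1∷suc : ∀ {n} {s : Seq (suc n)} → Valid s → Valid (1 ∷ map suc s)
valid-1∷suc (pos , uni , m , cov) =
  (λ { zero → s≤s z≤n ; (suc i) → s≤s z≤n })
  , unimodal-∷ (λ _ → s≤s z≤n) (unimodal-map suc s≤s uni) , suc m , covers-1∷suc cov

valid-1∷suc⁻¹ : ∀ {n} {s : Seq (suc n)} → Positive s → Valid (1 ∷ map suc s) → Valid s
valid-1∷suc⁻¹ pos (_ , uni , m , cov) =
  pos , unimodal-map pred pred-mono-≤ (unimodal-tail uni) , pred m , covers-1∷suc⁻¹ pos cov

1∉map-suc : ∀ {n} {s : Seq n} → Positive s → 1 ∉ map suc s
1∉map-suc pos (i , 1+sᵢ≡1) with () ← subst (1 ≤_) (suc-injective 1+sᵢ≡1) (pos i)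

positive-pred : ∀ {n} {s : Seq n} → Positive s → 1 ∉ s → Positive (map pred s)
positive-pred {s = s} pos 1∉s i with s i | pos i | 1∉s ∘ (i ,_)
... | suc zero | _ | sᵢ≢1 = ⊥-elim (sᵢ≢1 refl)
... | suc (suc _) | _ | _ = s≤s z≤n

map-suc-pred : ∀ {n} {s : Seq n} → Positive s → map suc (map pred s) ≗ s
map-suc-pred {s = s} pos i = suc-pred (s i) {{>-nonZero (pos i)}}

valid-pred-tail : ∀ {n} {s : Seq (suc (suc n))} →
                  Valid s → head s ≡ 1 → 1 ∉ tail s → Valid (map pred (tail s))
valid-pred-tail {s = s} v@(pos , _) head≡1 1∉tail =
  valid-1∷suc⁻¹ (positive-pred (pos ∘ suc) 1∉tail) (valid-resp unfold v)
  where
  unfold : s ≗ 1 ∷ map suc (map pred (tail s))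
  unfold zero = head≡1
  unfold (suc i) = sym (map-suc-pred (pos ∘ suc) i)

valid-pred-init : ∀ {n} {s : Seq (suc (suc n))} →
                  Valid s → last s ≡ 1 → 1 ∉ init s → Valid (map pred (init s))
valid-pred-init v last≡1 1∉init =
  valid-reverse⁻¹ (valid-pred-tail (valid-reverse v) last≡1 (1∉init ∘ ∈-reverse⁻¹))

-- Unimodal coverings are codes

toSeq : ∀ {n} → Code n → Seq n
toSeq⁺ : ∀ {n} → Code⁺ n → Seq n
toSeq single = λ _ → 1
toSeq (cons1 y) = 1 ∷ toSeq y
toSeq (cons1↑ y) = 1 ∷ map suc (toSeq y)
toSeq (tall z) = toSeq⁺ z
toSeq⁺ (snoc1↑ y) = map suc (toSeq y) ∷ʳ 1
toSeq⁺ (snoc1 z) = toSeq⁺ z ∷ʳ 1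

valid-toSeq : ∀ {n} (y : Code n) → Valid (toSeq y)
valid-toSeq⁺ : ∀ {n} (z : Code⁺ n) → Valid (toSeq⁺ z)
valid-toSeq single = valid-single
valid-toSeq (cons1 y) = valid-1∷ (valid-toSeq y)
valid-toSeq (cons1↑ y) = valid-1∷suc (valid-toSeq y)
valid-toSeq (tall z) = valid-toSeq⁺ z
valid-toSeq⁺ (snoc1↑ y) = valid-reverse (valid-1∷suc (valid-reverse (valid-toSeq y)))
valid-toSeq⁺ (snoc1 z) = valid-reverse (valid-1∷ (valid-reverse (valid-toSeq⁺ z)))

fromSeq : ∀ {n} → Seq (suc n) → Code (suc n)
fromSeq⁺ : ∀ {n} → Seq (suc (suc n)) → Code⁺ (suc (suc n))
fromSeq {n} s with head s ≟ 1 | 1 ∈? tail s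
fromSeq {zero} s | _ | _ = single
fromSeq {suc n} s | yes _ | yes _ = cons1 (fromSeq (tail s))
fromSeq {suc n} s | yes _ | no _ = cons1↑ (fromSeq (map pred (tail s)))
fromSeq {suc n} s | no _ | _ = tall (fromSeq⁺ s)
fromSeq⁺ {n} s with 1 ∈? init s
fromSeq⁺ {n} s | no _ = snoc1↑ (fromSeq (map pred (init s)))
-- Unreachable for coverings: here init s is just head s, which is not 1.
fromSeq⁺ {zero} s | yes _ = snoc1↑ (fromSeq (map pred (init s)))
fromSeq⁺ {suc n} s | yes _ = snoc1 (fromSeq⁺ (init s))

toSeq-fromSeq : ∀ {n} {s : Seq (suc n)} → Valid s → toSeq (fromSeq s) ≗ s
toSeq⁺-fromSeq⁺ : ∀ {n} {s : Seq (suc (suc n))} → Valid s → head s ≢ 1 → toSeq⁺ (fromSeq⁺ s) ≗ s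

toSeq-fromSeq {n} {s} v with head s ≟ 1 | 1 ∈? tail s
toSeq-fromSeq {zero} v | _ | _ with valid⇒1∈ v
... | zero , s₀≡1 = λ { zero → sym s₀≡1 }
toSeq-fromSeq {suc n} {s} v | yes head≡1 | yes 1∈tail = λ
  { zero → sym head≡1
  ; (suc i) → toSeq-fromSeq (valid-tail v (subst (_∈ tail s) (sym head≡1) 1∈tail)) i }
toSeq-fromSeq {suc n} {s} v | yes head≡1 | no 1∉tail = λ
  { zero → sym head≡1
  ; (suc i) → trans (cong suc (toSeq-fromSeq (valid-pred-tail v head≡1 1∉tail) i))
                    (map-suc-pred (proj₁ v ∘ suc) i) }
toSeq-fromSeq {suc n} v | no head≢1 | _ = toSeq⁺-fromSeq⁺ v head≢1

toSeq⁺-fromSeq⁺ {n} {s} v head≢1 with 1 ∈? init s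
toSeq⁺-fromSeq⁺ {zero} v head≢1 | yes (zero , s₀≡1) = ⊥-elim (head≢1 s₀≡1)
toSeq⁺-fromSeq⁺ {suc n} {s} v head≢1 | yes 1∈init = λ i →
  trans (∷ʳ-cong (toSeq⁺-fromSeq⁺ (valid-init v last∈init) head≢1) i) (init-∷ʳ-1 v head≢1 i)
  where
  last∈init : last s ∈ init s
  last∈init = subst (_∈ init s) (sym (valid-last≡1 v head≢1)) 1∈init
toSeq⁺-fromSeq⁺ {s = s} v head≢1 | no 1∉init = λ i →
  trans (∷ʳ-cong (λ j → trans (cong suc (toSeq-fromSeq valid-pred j)) (map-suc-pred (proj₁ v ∘ inject₁) j)) i)
        (init-∷ʳ-1 v head≢1 i)
  where
  valid-pred : Valid (map pred (init s))
  valid-pred = valid-pred-init v (valid-last≡1 v head≢1) 1∉init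

head-toSeq⁺≢1 : ∀ {n} (z : Code⁺ (suc n)) → head (toSeq⁺ z) ≢ 1
head-toSeq⁺≢1 (snoc1↑ y) = λ head≡1 →
  1∉map-suc (proj₁ (valid-toSeq y)) (zero , trans (sym (head-∷ʳ (map suc (toSeq y)) 1)) head≡1)
head-toSeq⁺≢1 (snoc1 z) = head-toSeq⁺≢1 z ∘ trans (sym (head-∷ʳ (toSeq⁺ z) 1))

cons1≢cons1↑ : ∀ {n} (y y' : Code (suc n)) → toSeq (cons1 y) ≗ toSeq (cons1↑ y') → ⊥
cons1≢cons1↑ y y' e = 1∉map-suc (proj₁ (valid-toSeq y')) (∈-resp (e ∘ suc) (valid⇒1∈ (valid-toSeq y)))

snoc1↑≢snoc1 : ∀ {n} (y : Code (suc n)) (z : Code⁺ (suc n)) →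
               toSeq⁺ (snoc1↑ y) ≗ toSeq⁺ (snoc1 z) → ⊥
snoc1↑≢snoc1 y z e =
  1∉map-suc (proj₁ (valid-toSeq y)) (∈-resp (sym ∘ ∷ʳ-injective e) (valid⇒1∈ (valid-toSeq⁺ z)))

toSeq-injective : ∀ {n} (y y' : Code n) → toSeq y ≗ toSeq y' → y ≡ y'
toSeq⁺-injective : ∀ {n} (z z' : Code⁺ n) → toSeq⁺ z ≗ toSeq⁺ z' → z ≡ z'

toSeq-injective single single _ = refl
toSeq-injective (cons1 y) (cons1 y') e = cong cons1 (toSeq-injective y y' (e ∘ suc))
toSeq-injective (cons1↑ y) (cons1↑ y') e = cong cons1↑ (toSeq-injective y y' (suc-injective ∘ e ∘ suc))
toSeq-injective (tall z) (tall z') e = cong tall (toSeq⁺-injective z z' e)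
toSeq-injective (cons1 y) (cons1↑ y') e = ⊥-elim (cons1≢cons1↑ y y' e)
toSeq-injective (cons1↑ y) (cons1 y') e = ⊥-elim (cons1≢cons1↑ y' y (sym ∘ e))
toSeq-injective (cons1 _) (tall z) e = ⊥-elim (head-toSeq⁺≢1 z (sym (e zero)))
toSeq-injective (cons1↑ _) (tall z) e = ⊥-elim (head-toSeq⁺≢1 z (sym (e zero)))
toSeq-injective (tall z) (cons1 _) e = ⊥-elim (head-toSeq⁺≢1 z (e zero))
toSeq-injective (tall z) (cons1↑ _) e = ⊥-elim (head-toSeq⁺≢1 z (e zero))

toSeq⁺-injective (snoc1↑ y) (snoc1↑ y') e =
  cong snoc1↑ (toSeq-injective y y' (suc-injective ∘ ∷ʳ-injective e))
toSeq⁺-injective (snoc1 z) (snoc1 z') e = cong snoc1 (toSeq⁺-injective z z' (∷ʳ-injective e))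
toSeq⁺-injective (snoc1↑ y) (snoc1 z) e = ⊥-elim (snoc1↑≢snoc1 y z e)
toSeq⁺-injective (snoc1 z) (snoc1↑ y) e = ⊥-elim (snoc1↑≢snoc1 y z (sym ∘ e))

module _ {a b ℓ₁ ℓ₂} (S : Setoid a ℓ₁) (T : Setoid b ℓ₂) where
  open Setoid S using () renaming (Carrier to A; _≈_ to _≈₁_)
  open Setoid T using () renaming (Carrier to B; _≈_ to _≈₂_)
  open Consequences S T

  strictInverse : (f : A → B) (g : B → A) → Congruent _≈₁_ _≈₂_ f → Congruent _≈₂_ _≈₁_ g
                → StrictlyInverseˡ _≈₂_ f g → StrictlyInverseʳ _≈₁_ f g → Inverse S T
  strictInverse f g f-cong g-cong invˡ invʳ = record
    { to = f
    ; from = g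
    ; to-cong = f-cong
    ; from-cong = g-cong
    ; inverse = strictlyInverseˡ⇒inverseˡ f-cong invˡ , strictlyInverseʳ⇒inverseʳ g-cong invʳ
    }

𝒰↔Code : ∀ n → Inverse (𝒰 (suc n)) (≡.setoid (Code (suc n)))
𝒰↔Code n = strictInverse (𝒰 (suc n)) (≡.setoid (Code (suc n)))
  (fromSeq ∘ proj₁) (λ y → toSeq y , valid-toSeq y)
  (λ {x} {x'} → fromSeq-cong {x} {x'}) (λ { refl _ → refl })
  (λ y → toSeq-injective _ y (toSeq-fromSeq {s = toSeq y} (valid-toSeq y)))
  (λ (s , v) → toSeq-fromSeq {s = s} v)
  where
  fromSeq-cong : ∀ {x x' : Σ (Seq (suc n)) Valid} →
                 proj₁ x ≗ proj₁ x' → fromSeq (proj₁ x) ≡ fromSeq (proj₁ x')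
  fromSeq-cong {_ , v} {_ , v'} e =
    toSeq-injective _ _ λ i → trans (toSeq-fromSeq v i) (trans (e i) (sym (toSeq-fromSeq v' i)))

-- Coloured compositions are codes

Fodd Feven : ℕ → ℕ
Fodd zero = 1
Fodd (suc k) = Feven (suc k) + Fodd k
Feven zero = 0
Feven (suc k) = Fodd k + Feven k

F-odd-even : ∀ k → F (suc (k + k)) ≡ Fodd k × F (k + k) ≡ Feven k
F-odd-even zero = refl , refl
F-odd-even (suc k) rewrite +-suc k k with F-odd-even k
... | odd , even = cong₂ _+_ (cong₂ _+_ odd even) odd , cong₂ _+_ odd even

wF-suc : ∀ k → wF (suc k) ≡ Fodd k
wF-suc k = begin
  F (k + suc (k + 0)) ≡⟨ cong F (trans (+-suc k (k + 0)) (cong (λ m → suc (k + m)) (+-identityʳ k))) ⟩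
  F (suc (k + k))     ≡⟨ proj₁ (F-odd-even k) ⟩
  Fodd k              ∎
  where open ≡-Reasoning

Part : Set
Part = ColoredPart wF

weight : List Part → ℕ
weight l = sum (List.map proj₁ l)

toFodd : ∀ k → Fin (wF (suc k)) → Fin (Fodd k)
toFodd k = cast (wF-suc k)

fromFodd : ∀ k → Fin (Fodd k) → Fin (wF (suc k))
fromFodd k = cast (sym (wF-suc k))

toFodd-fromFodd : ∀ k (c : Fin (Fodd k)) → toFodd k (fromFodd k c) ≡ c
toFodd-fromFodd k = cast-involutive (wF-suc k) (sym (wF-suc k))

fromFodd-toFodd : ∀ k (c : Fin (wF (suc k))) → fromFodd k (toFodd k c) ≡ c
fromFodd-toFodd k = cast-involutive (sym (wF-suc k)) (wF-suc k)

-- ((k , c) , t) is the composition with first part suc k, coloured c, followed by t.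
Lead : Set
Lead = Σ ℕ (Fin ∘ Fodd) × List Part

-- ((k , c) , t) has first part suc (suc k), coloured from the first block of
-- Fodd (suc k) = Feven (suc k) + Fodd k.
Lead⁺ : Set
Lead⁺ = Σ ℕ (Fin ∘ Feven ∘ suc) × List Part

toList : Lead → List Part
toList ((k , c) , t) = (suc k , fromFodd k c) ∷ₗ t

size⁺ : Lead⁺ → ℕ
size⁺ ((k , _) , t) = suc (suc k) + weight t

extendʳ : Lead → Lead
extendʳ ((k , c) , t) = (suc k , Feven (suc k) ↑ʳ c) , t

extendˡ : Lead⁺ → Lead
extendˡ ((k , c) , t) = (suc k , c ↑ˡ Fodd k) , t

extend⁺ˡ : Lead → Lead⁺
extend⁺ˡ ((k , c) , t) = (k , c ↑ˡ Feven k) , t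

extend⁺ʳ : Lead⁺ → Lead⁺
extend⁺ʳ ((k , c) , t) = (suc k , Fodd (suc k) ↑ʳ c) , t

toLead : ∀ {n} → Code n → Lead
toLead⁺ : ∀ {n} → Code⁺ n → Lead⁺
toLead single = (0 , zero) , []
toLead (cons1 y) = (0 , zero) , toList (toLead y)
toLead (cons1↑ y) = extendʳ (toLead y)
toLead (tall z) = extendˡ (toLead⁺ z)
toLead⁺ (snoc1↑ y) = extend⁺ˡ (toLead y)
toLead⁺ (snoc1 z) = extend⁺ʳ (toLead⁺ z)

weight-toLead : ∀ {n} (y : Code n) → weight (toList (toLead y)) ≡ n
size⁺-toLead⁺ : ∀ {n} (z : Code⁺ n) → size⁺ (toLead⁺ z) ≡ n
weight-toLead single = refl
weight-toLead (cons1 y) = cong suc (weight-toLead y)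
weight-toLead (cons1↑ y) = cong suc (weight-toLead y)
weight-toLead (tall z) = size⁺-toLead⁺ z
size⁺-toLead⁺ (snoc1↑ y) = cong suc (weight-toLead y)
size⁺-toLead⁺ (snoc1 z) = cong suc (size⁺-toLead⁺ z)

fromList : (l : List Part) (n : ℕ) → weight l ≡ suc n → Code (suc n)
fromLead : (l : Lead) (n : ℕ) → weight (toList l) ≡ suc n → Code (suc n)
fromSplit : ∀ k → Fin (Feven (suc k)) ⊎ Fin (Fodd k) → (t : List Part) (n : ℕ)
            → suc (suc k) + weight t ≡ suc (suc n) → Code (suc (suc n))
fromLead⁺ : (l : Lead⁺) (n : ℕ) → size⁺ l ≡ suc (suc n) → Code⁺ (suc (suc n))
fromSplit⁺ : ∀ k → Fin (Fodd k) ⊎ Fin (Feven k) → (t : List Part) (n : ℕ)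
             → suc (suc k) + weight t ≡ suc (suc n) → Code⁺ (suc (suc n))

fromList ((suc k , c) ∷ₗ t) n eq = fromLead ((k , toFodd k c) , t) n eq
fromLead ((zero , zero) , []) zero refl = single
fromLead ((zero , zero) , p@(suc _ , _) ∷ₗ t) (suc n) eq = cons1 (fromList (p ∷ₗ t) n (suc-injective eq))
fromLead ((suc k , c) , t) (suc n) eq = fromSplit k (splitAt (Feven (suc k)) c) t n eq
fromSplit k (inj₁ c) t n eq = tall (fromLead⁺ ((k , c) , t) n eq)
fromSplit k (inj₂ c) t n eq = cons1↑ (fromLead ((k , c) , t) n (suc-injective eq))
fromLead⁺ ((k , c) , t) n eq = fromSplit⁺ k (splitAt (Fodd k) c) t n eq
fromSplit⁺ k (inj₁ c) t n eq = snoc1↑ (fromLead ((k , c) , t) n (suc-injective eq))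
fromSplit⁺ (suc k) (inj₂ c) t (suc n) eq = snoc1 (fromLead⁺ ((k , c) , t) n (suc-injective eq))

fromList-toList : ∀ l n eq → fromList (toList l) n eq ≡ fromLead l n eq
fromList-toList ((k , c) , t) n eq = cong (λ c → fromLead ((k , c) , t) n eq) (toFodd-fromFodd k c)

toList-toLead-fromList : ∀ l n eq → toList (toLead (fromList l n eq)) ≡ l
toLead-fromLead : ∀ l n eq → toLead (fromLead l n eq) ≡ l
toLead-fromSplit : ∀ k d t n eq → toLead (fromSplit k d t n eq) ≡ ((suc k , join _ _ d) , t)
toLead⁺-fromLead⁺ : ∀ l n eq → toLead⁺ (fromLead⁺ l n eq) ≡ l
toLead⁺-fromSplit⁺ : ∀ k d t n eq → toLead⁺ (fromSplit⁺ k d t n eq) ≡ ((k , join _ _ d) , t)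

toList-toLead-fromList ((suc k , c) ∷ₗ t) n eq =
  trans (cong toList (toLead-fromLead ((k , toFodd k c) , t) n eq))
        (cong (λ c → (suc k , c) ∷ₗ t) (fromFodd-toFodd k c))
toLead-fromLead ((zero , zero) , []) zero refl = refl
toLead-fromLead ((zero , zero) , p@(suc _ , _) ∷ₗ t) (suc n) eq =
  cong ((0 , zero) ,_) (toList-toLead-fromList (p ∷ₗ t) n (suc-injective eq))
toLead-fromLead ((suc k , c) , t) (suc n) eq =
  trans (toLead-fromSplit k (splitAt (Feven (suc k)) c) t n eq)
        (cong (λ c → (suc k , c) , t) (join-splitAt (Feven (suc k)) (Fodd k) c))
toLead-fromSplit k (inj₁ c) t n eq = cong extendˡ (toLead⁺-fromLead⁺ ((k , c) , t) n eq)
toLead-fromSplit k (inj₂ c) t n eq = cong extendʳ (toLead-fromLead ((k , c) , t) n (suc-injective eq))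
toLead⁺-fromLead⁺ ((k , c) , t) n eq =
  trans (toLead⁺-fromSplit⁺ k (splitAt (Fodd k) c) t n eq)
        (cong (λ c → (k , c) , t) (join-splitAt (Fodd k) (Feven k) c))
toLead⁺-fromSplit⁺ k (inj₁ c) t n eq = cong extend⁺ˡ (toLead-fromLead ((k , c) , t) n (suc-injective eq))
toLead⁺-fromSplit⁺ (suc k) (inj₂ c) t (suc n) eq =
  cong extend⁺ʳ (toLead⁺-fromLead⁺ ((k , c) , t) n (suc-injective eq))

fromLead-toLead : ∀ {n} (y : Code (suc n)) eq → fromLead (toLead y) n eq ≡ y
fromLead⁺-toLead⁺ : ∀ {n} (z : Code⁺ (suc (suc n))) eq → fromLead⁺ (toLead⁺ z) n eq ≡ z
fromLead-toLead single refl = refl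
fromLead-toLead (cons1 y) eq = cong cons1 (trans (fromList-toList (toLead y) _ _) (fromLead-toLead y _))
fromLead-toLead {suc n} (cons1↑ y) eq =
  let (k , c) , t = toLead y in
  trans (cong (λ d → fromSplit k d t n eq) (splitAt-↑ʳ (Feven (suc k)) (Fodd k) c))
        (cong cons1↑ (fromLead-toLead y _))
fromLead-toLead {suc n} (tall z) eq =
  let (k , c) , t = toLead⁺ z in
  trans (cong (λ d → fromSplit k d t n eq) (splitAt-↑ˡ (Feven (suc k)) c (Fodd k)))
        (cong tall (fromLead⁺-toLead⁺ z _))
fromLead⁺-toLead⁺ {n} (snoc1↑ y) eq =
  let (k , c) , t = toLead y in
  trans (cong (λ d → fromSplit⁺ k d t n eq) (splitAt-↑ˡ (Fodd k) c (Feven k)))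
        (cong snoc1↑ (fromLead-toLead y _))
fromLead⁺-toLead⁺ {suc n} (snoc1 z) eq =
  let (k , c) , t = toLead⁺ z in
  trans (cong (λ d → fromSplit⁺ (suc k) d t (suc n) eq) (splitAt-↑ʳ (Fodd (suc k)) (Feven (suc k)) c))
        (cong snoc1 (fromLead⁺-toLead⁺ z _))

part-positive : (p : Part) → 1 ≤ proj₁ p
part-positive (suc _ , _) = s≤s z≤n

𝒞↔Code : ∀ n → Inverse (𝒞 wF (suc n)) (≡.setoid (Code (suc n)))
𝒞↔Code n = strictInverse (𝒞 wF (suc n)) (≡.setoid (Code (suc n)))
  (λ (l , _ , eq) → fromList l n eq)
  (λ y → toList (toLead y) , universal part-positive _ , weight-toLead y)
  (λ {x} {x'} → fromList-cong {x} {x'}) (cong (toList ∘ toLead))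
  (λ y → trans (fromList-toList (toLead y) n _) (fromLead-toLead y _))
  (λ (l , _ , eq) → toList-toLead-fromList l n eq)
  where
  fromList-cong : ∀ {x x' : Σ (List Part) (IsColComp wF (suc n))} → proj₁ x ≡ proj₁ x'
                  → fromList (proj₁ x) n (proj₂ (proj₂ x)) ≡ fromList (proj₁ x') n (proj₂ (proj₂ x'))
  fromList-cong {l , _ , eq} {_ , _ , eq'} refl = cong (fromList l n) (≡-irrelevant eq eq')

theorem5p5 : (n : ℕ) → 1 ≤ n →
    Bijection (𝒞 wF n) (𝒰 n) × Bijection (𝒰 n) (≡.setoid (Fin (b n)))
theorem5p5 (suc n) _ rewrite b≡#Code (suc n) =
  Inverse⇒Bijection (Compose.inverse (𝒞↔Code n) (Symmetry.inverse (𝒰↔Code n)))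
  , Inverse⇒Bijection (Compose.inverse (𝒰↔Code n) (Code↔Fin (suc n)))
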